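{- Let $F$ be a forest with no isolated vertices. Then $$\frac13\big(|\mathit{Deg}_{\ge2}(F)|+|\mathit{Supp}(F)|\big)\le\phi(F)\le\frac12\big(|\mathit{Deg}_{\ge2}(F)|+|\mathit{Supp}(F)|\big).$$
   Context: $\phi(F)$ is the matching number (size of a maximum matching) of $F$. $\mathit{Deg}_{\ge2}(F)$ is the set of vertices of degree at least $2$. $\mathit{Supp}(F)$ is the set of support vertices, i.e., vertices adjacent to at least one leaf (vertex of degree $1$). -}

module Defs where

open import Data.Bool using (Bool; true; false; T)
open import Data.Nat using (ℕ; zero; suc; _+_; _*_; _≤_; _≥_; _≤?_)
open import Data.Fin using (Fin)
open import Data.List using (List; []; _∷_; length; filter; allFin; concatMap)
open import Data.List.Relation.Unary.All using (All)
open import Data.List.Relation.Unary.Any using (Any)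
open import Data.List.Relation.Unary.Unique.Propositional using (Unique)
open import Data.List.Relation.Unary.Linked using (Linked)
open import Data.Maybe using (just)
open import Data.Product using (_×_; _,_; Σ; ∃)
open import Relation.Binary.PropositionalEquality using (_≡_)
open import Relation.Nullary using (¬_)
open import Relation.Nullary.Decidable using (does)
open import Relation.Unary using (Decidable)

record Graph (n : ℕ) : Set where
  field
    adj   : Fin n → Fin n → Bool
    sym   : ∀ u v → adj u v ≡ adj v u
    irrefl : ∀ v → adj v v ≡ false

open Graph public

Adj : ∀ {n} → Graph n → Fin n → Fin n → Set
Adj G u v = T (adj G u v)

countB : ∀ {n} → (Fin n → Bool) → ℕ
countB {n} p = length (filter (λ v → T? (p v)) (allFin n))
  where
  open import Data.Bool.Properties using (T?)

degree : ∀ {n} → Graph n → Fin n → ℕ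
degree G v = countB (adj G v)

lastOf : ∀ {n} → Fin n → List (Fin n) → Fin n
lastOf x []       = x
lastOf x (y ∷ ys) = lastOf y ys

record Cycle {n : ℕ} (G : Graph n) : Set where
  field
    v₀ v₁ v₂ : Fin n
    rest     : List (Fin n)
    distinct : Unique (v₀ ∷ v₁ ∷ v₂ ∷ rest)
    path     : Linked (Adj G) (v₀ ∷ v₁ ∷ v₂ ∷ rest)
    closing  : Adj G (lastOf v₂ rest) v₀

IsForest : ∀ {n} → Graph n → Set
IsForest G = ¬ Cycle G

NoIsolatedVertices : ∀ {n} → Graph n → Set
NoIsolatedVertices G = ∀ v → 1 ≤ degree G v

deg≥2Count : ∀ {n} → Graph n → ℕ
deg≥2Count G = countB (λ v → does (2 ≤? degree G v))

isLeaf : ∀ {n} → Graph n → Fin n → Bool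
isLeaf G v = does (degree G v Data.Nat.≟ 1)
  where import Data.Nat

isSupport : ∀ {n} → Graph n → Fin n → Bool
isSupport {n} G v = any (λ u → adj G v u ∧ isLeaf G u) (allFin n)
  where
  open import Data.Bool.ListAction using (any)
  open import Data.Bool using (_∧_)

suppCount : ∀ {n} → Graph n → ℕ
suppCount G = countB (isSupport G)

endpoints : ∀ {n} → List (Fin n × Fin n) → List (Fin n)
endpoints = concatMap (λ { (u , v) → u ∷ v ∷ [] })

IsMatching : ∀ {n} → Graph n → List (Fin n × Fin n) → Set
IsMatching G M = All (λ { (u , v) → Adj G u v }) M × Unique (endpoints M)

IsMaximumMatching : ∀ {n} → Graph n → List (Fin n × Fin n) → Set
IsMaximumMatching G M =
  IsMatching G M × (∀ M′ → IsMatching G M′ → length M′ ≤ length M)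

-- Upper bound: if ab is an edge and a has degree 1, then b is a support vertex.  Hence every
-- edge ab of a matching has a ∈ Deg≥2 or b ∈ Supp, and likewise b ∈ Deg≥2 or a ∈ Supp; as the
-- endpoints of a matching are distinct, each edge contributes at least 2 to |Deg≥2| + |Supp|.
--
-- Lower bound: a forest with an edge contains a pendant star, a vertex c with a leaf ℓ such that
-- all neighbours of c but at most one are leaves; it sits at the end of a path that cannot be
-- prolonged.  Deleting the edges at c removes at most three vertices from Deg≥2 or Supp, and cℓ
-- extends any matching of the remaining forest, so induction on the number of non-isolated
-- vertices gives |Deg≥2| + |Supp| ≤ 3 φ.

module Submission where

open import Data.Bool using (Bool; true; false; T; _∧_; _∨_; not)
open import Data.Bool.ListAction using (any)
open import Data.Bool.Properties using (T?; T-∧; T-∨; ∧-comm)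
open import Data.Fin using (Fin) renaming (_≟_ to _≟ᶠ_)
open import Data.Fin.Properties using (any?)
open import Data.List using (List; []; _∷_; [_]; _++_; length; filterᵇ; allFin)
open import Data.List.Membership.Propositional using (_∈_; _∉_; lose)
open import Data.List.Membership.Propositional.Properties
  using (∈-∃++; ∈-++⁻; ∈-++⁺ˡ; ∈-++⁺ʳ; ∈-filter⁺; ∈-filter⁻; ∈-allFin)
open import Data.List.Properties using (length-++; length-++-sucʳ; length-tabulate)
open import Data.List.Relation.Binary.Subset.Propositional using (_⊆_)
open import Data.List.Relation.Unary.All using (All; []; _∷_)
import Data.List.Relation.Unary.All as All
open import Data.List.Relation.Unary.All.Properties using (¬Any⇒All¬)
open import Data.List.Relation.Unary.AllPairs using (AllPairs; []; _∷_)
import Data.List.Relation.Unary.AllPairs as AllPairs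
open import Data.List.Relation.Unary.Any using (here; there; satisfied)
open import Data.List.Relation.Unary.Any.Properties using (any⁺; any⁻)
open import Data.List.Relation.Unary.Linked using (Linked; []; [-]; _∷_)
import Data.List.Relation.Unary.Linked as Linked
open import Data.List.Relation.Unary.Unique.Propositional using (Unique)
import Data.List.Relation.Unary.Unique.Propositional.Properties as Unique
open import Data.Nat using (ℕ; zero; suc; _+_; _*_; _≤_; _<_; z≤n; s≤s; _≤?_; _≟_)
open import Data.Nat.Properties
open import Data.Nat.Tactic.RingSolver using (solve-∀)
open import Algebra.Properties.CommutativeSemigroup +-commutativeSemigroup
  renaming (interchange to +-interchange)
open import Data.Product using (_×_; _,_; proj₁; proj₂; ∃)
open import Data.Sum using (_⊎_; inj₁; inj₂)
open import Function using (_∘_; id; Equivalence)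
open import Relation.Binary.PropositionalEquality
  using (_≡_; _≢_; refl; sym; trans; cong; cong₂; subst)
open import Relation.Nullary using (¬_; contradiction; Dec; yes; no; does; ¬?; _×-dec_)

open import Defs hiding (sym)

private variable
  A : Set
  n : ℕ

-- Counting

Unique-⊆⇒length≤ : {xs ys : List A} → Unique xs → xs ⊆ ys → length xs ≤ length ys
Unique-⊆⇒length≤ {xs = []} _ _ = z≤n
Unique-⊆⇒length≤ {xs = x ∷ xs} (x∉xs ∷ unique) xs⊆ys
  with us , vs , refl ← ∈-∃++ (xs⊆ys (here refl)) =
  subst (suc (length xs) ≤_) (sym (length-++-sucʳ us x vs))
    (s≤s (Unique-⊆⇒length≤ unique λ t∈xs → drop-x (xs⊆ys (there t∈xs)) (All.lookup x∉xs t∈xs ∘ sym)))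
  where
  drop-x : ∀ {t} → t ∈ us ++ x ∷ vs → t ≢ x → t ∈ us ++ vs
  drop-x t∈ t≢x with ∈-++⁻ us t∈
  ... | inj₁ t∈us = ∈-++⁺ˡ t∈us
  ... | inj₂ (here t≡x) = contradiction t≡x t≢x
  ... | inj₂ (there t∈vs) = ∈-++⁺ʳ us t∈vs

-- countB p is definitionally length (satisfying p)
satisfying : (Fin n → Bool) → List (Fin n)
satisfying {n} p = filterᵇ p (allFin n)

∈-satisfying⁺ : {p : Fin n → Bool} {x : Fin n} → T (p x) → x ∈ satisfying p
∈-satisfying⁺ {p = p} {x} = ∈-filter⁺ (T? ∘ p) (∈-allFin x)

∈-satisfying⁻ : {p : Fin n → Bool} {x : Fin n} → x ∈ satisfying p → T (p x)
∈-satisfying⁻ {n} {p = p} = proj₂ ∘ ∈-filter⁻ (T? ∘ p) {xs = allFin n}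

satisfying-unique : (p : Fin n → Bool) → Unique (satisfying p)
satisfying-unique {n} p = Unique.filter⁺ (T? ∘ p) {allFin n} (Unique.allFin⁺ n)

countB-⊆-∪ : {p q : Fin n → Bool} (E : List (Fin n)) → (∀ {x} → T (p x) → T (q x) ⊎ x ∈ E) →
             countB p ≤ countB q + length E
countB-⊆-∪ {p = p} {q} E p⊆q∪E = subst (countB p ≤_) (length-++ (satisfying q))
  (Unique-⊆⇒length≤ (satisfying-unique p) λ x∈p → into (p⊆q∪E (∈-satisfying⁻ x∈p)))
  where
  into : ∀ {x} → T (q x) ⊎ x ∈ E → x ∈ satisfying q ++ E
  into (inj₁ qx) = ∈-++⁺ˡ (∈-satisfying⁺ qx)
  into (inj₂ x∈E) = ∈-++⁺ʳ (satisfying q) x∈E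

countB-< : {p q : Fin n → Bool} {a : Fin n} → (∀ {x} → T (p x) → T (q x)) → T (q a) → ¬ T (p a) →
           countB p < countB q
countB-< {p = p} {q} {a} p⊆q qa ¬pa =
  Unique-⊆⇒length≤ (All.tabulate a≢ ∷ satisfying-unique p) a∷p⊆q
  where
  a≢ : ∀ {x} → x ∈ satisfying p → a ≢ x
  a≢ x∈p refl = ¬pa (∈-satisfying⁻ x∈p)
  a∷p⊆q : a ∷ satisfying p ⊆ satisfying q
  a∷p⊆q (here refl) = ∈-satisfying⁺ qa
  a∷p⊆q (there x∈p) = ∈-satisfying⁺ (p⊆q (∈-satisfying⁻ x∈p))

countB-none : {p : Fin n → Bool} → (∀ x → ¬ T (p x)) → countB p ≤ 0
countB-none {p = p} never = Unique-⊆⇒length≤ {ys = []} (satisfying-unique p)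
  λ x∈p → contradiction (∈-satisfying⁻ x∈p) (never _)

count : (A → Bool) → List A → ℕ
count p xs = length (filterᵇ p xs)

bit : Bool → ℕ
bit false = 0
bit true = 1

count-∷ : (p : A → Bool) (x : A) (xs : List A) → count p (x ∷ xs) ≡ bit (p x) + count p xs
count-∷ p x xs with p x
... | true = refl
... | false = refl

bit-∨ : ∀ {a b} → T (a ∨ b) → 1 ≤ bit a + bit b
bit-∨ {true} _ = s≤s z≤n
bit-∨ {false} {true} _ = s≤s z≤n

count≤countB : (p : Fin n → Bool) {xs : List (Fin n)} → Unique xs → count p xs ≤ countB p
count≤countB p {xs} unique = Unique-⊆⇒length≤ {ys = satisfying p} (Unique.filter⁺ (T? ∘ p) unique)
  (∈-satisfying⁺ {p = p} ∘ proj₂ ∘ ∈-filter⁻ (T? ∘ p) {xs = xs})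

-- Degrees, supports and the upper bound

T-does⁺ : {P : Set} (P? : Dec P) → P → T (does P?)
T-does⁺ (yes _) _ = _
T-does⁺ (no ¬p) p = ¬p p

T-does⁻ : {P : Set} (P? : Dec P) → T (does P?) → P
T-does⁻ (yes p) _ = p

module _ (G : Graph n) where

  adj-sym : ∀ {x y} → Adj G x y → Adj G y x
  adj-sym {x} {y} = subst T (Graph.sym G x y)

  adj⇒≢ : ∀ {x y} → Adj G x y → x ≢ y
  adj⇒≢ {x} x~x refl = subst T (irrefl G x) x~x

  Pendant : Fin n → Fin n → Set
  Pendant u v = Adj G u v × (∀ t → Adj G u t → t ≡ v)

  neighbours : Fin n → List (Fin n)
  neighbours x = satisfying (adj G x)

  degree-≥1 : ∀ {x y} → Adj G x y → 1 ≤ degree G x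
  degree-≥1 {x} x~y = Unique-⊆⇒length≤ {ys = neighbours x} ([] ∷ []) λ
    { (here refl) → ∈-satisfying⁺ x~y }

  degree-≥2 : ∀ {x y z} → Adj G x y → Adj G x z → y ≢ z → 2 ≤ degree G x
  degree-≥2 {x} x~y x~z y≢z = Unique-⊆⇒length≤ {ys = neighbours x} ((y≢z ∷ []) ∷ [] ∷ []) λ
    { (here refl) → ∈-satisfying⁺ x~y ; (there (here refl)) → ∈-satisfying⁺ x~z }

  pendant⇒degree≡1 : ∀ {x y} → Pendant x y → degree G x ≡ 1
  pendant⇒degree≡1 {x} (x~y , only-y) = ≤-antisym
    (Unique-⊆⇒length≤ {ys = [ _ ]} (satisfying-unique (adj G x))
      λ t∈ → here (only-y _ (∈-satisfying⁻ t∈)))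
    (degree-≥1 x~y)

  degree≡1⇒pendant : ∀ {x y} → degree G x ≡ 1 → Adj G x y → Pendant x y
  degree≡1⇒pendant {x} {y} deg≡1 x~y = x~y , only-y
    where
    only-y : ∀ t → Adj G x t → t ≡ y
    only-y t x~t with t ≟ᶠ y
    ... | yes t≡y = t≡y
    ... | no t≢y = contradiction (subst (2 ≤_) deg≡1 (degree-≥2 x~t x~y t≢y)) (<-irrefl refl)

  hasDeg≥2 : Fin n → Bool
  hasDeg≥2 x = does (2 ≤? degree G x)

  support⁺ : ∀ {x y} → Adj G x y → degree G y ≡ 1 → T (isSupport G x)
  support⁺ {x} {y} x~y deg≡1 = any⁺ _ (lose (∈-allFin y)
    (Equivalence.from T-∧ (x~y , T-does⁺ (degree G y ≟ 1) deg≡1)))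

  support⁻ : ∀ {x} → T (isSupport G x) → ∃ λ y → Adj G x y × degree G y ≡ 1
  support⁻ {x} supp with y , x~y∧leaf ← satisfied (any⁻ _ (allFin n) supp)
    with x~y , leaf ← Equivalence.to T-∧ x~y∧leaf = y , x~y , T-does⁻ (degree G y ≟ 1) leaf

  edge-credit : ∀ {a b} → Adj G a b → T (hasDeg≥2 a ∨ isSupport G b)
  edge-credit {a} a~b with 2 ≤? degree G a
  ... | yes deg≥2 = Equivalence.from T-∨ (inj₁ (T-does⁺ (2 ≤? degree G a) deg≥2))
  ... | no deg≱2 = Equivalence.from T-∨
    (inj₂ (support⁺ (adj-sym a~b) (≤-antisym (≤-pred (≰⇒> deg≱2)) (degree-≥1 a~b))))

  credits : {p q : Fin n → Bool} → (∀ {a b} → Adj G a b → T (p a ∨ q b)) →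
            ∀ M → All (λ { (a , b) → Adj G a b }) M →
            2 * length M ≤ count p (endpoints M) + count q (endpoints M)
  credits earns [] [] = z≤n
  credits {p} {q} earns ((a , b) ∷ M) (a~b ∷ M-edges) = begin
    2 * suc (length M)                                ≡⟨ *-suc 2 (length M) ⟩
    1 + 1 + 2 * length M                              ≤⟨ +-mono-≤ (+-mono-≤ credit-ab credit-ba) credit-M ⟩
    (pa + qb) + (pb + qa) + (count p E + count q E)   ≡⟨ shuffle pa qb pb qa _ _ ⟩
    (pa + (pb + count p E)) + (qa + (qb + count q E)) ≡⟨ cong₂ _+_ (count-∷₂ p) (count-∷₂ q) ⟨
    count p (a ∷ b ∷ E) + count q (a ∷ b ∷ E)         ∎
    where
    open ≤-Reasoning
    E = endpoints M
    pa = bit (p a)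
    pb = bit (p b)
    qa = bit (q a)
    qb = bit (q b)
    credit-ab : 1 ≤ pa + qb
    credit-ab = bit-∨ {p a} (earns a~b)
    credit-ba : 1 ≤ pb + qa
    credit-ba = bit-∨ {p b} (earns (adj-sym a~b))
    credit-M : 2 * length M ≤ count p E + count q E
    credit-M = credits {p} {q} earns M M-edges
    count-∷₂ : ∀ r → count r (a ∷ b ∷ E) ≡ bit (r a) + (bit (r b) + count r E)
    count-∷₂ r = trans (count-∷ r a (b ∷ E)) (cong (bit (r a) +_) (count-∷ r b E))
    shuffle : ∀ w x y z u v → (w + x) + (y + z) + (u + v) ≡ (w + (y + u)) + (z + (x + v))
    shuffle = solve-∀

  matching-upper : ∀ {M} → IsMatching G M → 2 * length M ≤ deg≥2Count G + suppCount G
  matching-upper {M} (edges , unique) = ≤-trans (credits {hasDeg≥2} {isSupport G} edge-credit M edges)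
    (+-mono-≤ (count≤countB hasDeg≥2 unique) (count≤countB (isSupport G) unique))

-- Paths in forests and pendant stars

-- x ∷ prefixTo x xs y∈ is the initial segment of x ∷ xs that ends at y
prefixTo : {y : Fin n} (x : Fin n) (xs : List (Fin n)) → y ∈ x ∷ xs → List (Fin n)
prefixTo x xs (here _) = []
prefixTo x (x′ ∷ xs) (there y∈) = x′ ∷ prefixTo x′ xs y∈

module _ {y : Fin n} where

  lastOf-prefixTo : ∀ x xs (y∈ : y ∈ x ∷ xs) → lastOf x (prefixTo x xs y∈) ≡ y
  lastOf-prefixTo x xs (here y≡x) = sym y≡x
  lastOf-prefixTo x (x′ ∷ xs) (there y∈) = lastOf-prefixTo x′ xs y∈

  All-prefixTo : {P : Fin n → Set} → ∀ x xs (y∈ : y ∈ x ∷ xs) →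
                 All P xs → All P (prefixTo x xs y∈)
  All-prefixTo x xs (here _) _ = []
  All-prefixTo x (x′ ∷ xs) (there y∈) (px′ ∷ pxs) = px′ ∷ All-prefixTo x′ xs y∈ pxs

  AllPairs-prefixTo : {R : Fin n → Fin n → Set} → ∀ x xs (y∈ : y ∈ x ∷ xs) →
                      AllPairs R (x ∷ xs) → AllPairs R (x ∷ prefixTo x xs y∈)
  AllPairs-prefixTo x xs (here _) _ = [] ∷ []
  AllPairs-prefixTo x (x′ ∷ xs) (there y∈) ((rx′ ∷ rxs) ∷ pairs) =
    (rx′ ∷ All-prefixTo x′ xs y∈ rxs) ∷ AllPairs-prefixTo x′ xs y∈ pairs

  Linked-prefixTo : {R : Fin n → Fin n → Set} → ∀ x xs (y∈ : y ∈ x ∷ xs) →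
                    Linked R (x ∷ xs) → Linked R (x ∷ prefixTo x xs y∈)
  Linked-prefixTo x xs (here _) _ = [-]
  Linked-prefixTo x (x′ ∷ xs) (there y∈) (rx′ ∷ linked) = rx′ ∷ Linked-prefixTo x′ xs y∈ linked

record Path (G : Graph n) : Set where
  constructor mkPath
  field
    end next : Fin n
    beyond   : List (Fin n)
    unique   : Unique (end ∷ next ∷ beyond)
    linked   : Linked (Adj G) (end ∷ next ∷ beyond)

  vertices : List (Fin n)
  vertices = end ∷ next ∷ beyond

  end~next : Adj G end next
  end~next = Linked.head linked

  -- the neighbour of next on the path other than end, or end itself if there is none
  afterNext : Fin n
  afterNext with beyond
  ... | []    = end
  ... | w ∷ _ = w

open Path

record PendantStar (G : Graph n) : Set where
  field
    centre leaf exit  : Fin n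
    leaf-pendant      : Pendant G leaf centre
    neighbour-pendant : ∀ z → Adj G centre z → z ≡ exit ⊎ Pendant G z centre

path-length≤ : {G : Graph n} (p : Path G) → length (vertices p) ≤ n
path-length≤ {n} p = subst (length (vertices p) ≤_) (length-tabulate id)
  (Unique-⊆⇒length≤ {ys = allFin n} (unique p) (λ {x} _ → ∈-allFin x))

module _ (G : Graph n) where

  OtherNeighbour : Fin n → Fin n → Set
  OtherNeighbour x y = ∃ λ t → Adj G x t × t ≢ y

  otherNeighbour? : ∀ x y → Dec (OtherNeighbour x y)
  otherNeighbour? x y = any? λ t → T? (adj G x t) ×-dec ¬? (t ≟ᶠ y)

  pendant-unless-other : ∀ {x y} → Adj G x y → ¬ OtherNeighbour x y → Pendant G x y
  pendant-unless-other {x} {y} x~y no-other = x~y , only-y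
    where
    only-y : ∀ t → Adj G x t → t ≡ y
    only-y t x~t with t ≟ᶠ y
    ... | yes t≡y = t≡y
    ... | no t≢y = contradiction (t , x~t , t≢y) no-other

module _ {G : Graph n} (forest : IsForest G) where

  -- otherwise x, x₁, …, y would be a cycle
  forest-no-chord : ∀ {x x₁ xs y} → Unique (x ∷ x₁ ∷ xs) → Linked (Adj G) (x ∷ x₁ ∷ xs) →
                    Adj G x y → y ∉ xs
  forest-no-chord {x} {x₁} {x₂ ∷ xs} ((x≢x₁ ∷ x≢x₂ ∷ x≢xs) ∷ (x₁≢x₂ ∷ x₁≢xs) ∷ unique)
                  (x~x₁ ∷ x₁~x₂ ∷ linked) x~y y∈ = forest record
    { v₀ = x ; v₁ = x₁ ; v₂ = x₂ ; rest = prefixTo x₂ xs y∈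
    ; distinct = (x≢x₁ ∷ x≢x₂ ∷ All-prefixTo x₂ xs y∈ x≢xs)
               ∷ (x₁≢x₂ ∷ All-prefixTo x₂ xs y∈ x₁≢xs)
               ∷ AllPairs-prefixTo x₂ xs y∈ unique
    ; path = x~x₁ ∷ x₁~x₂ ∷ Linked-prefixTo x₂ xs y∈ linked
    ; closing = subst (λ t → Adj G t x) (sym (lastOf-prefixTo x₂ xs y∈)) (adj-sym G x~y) }

  extend : ∀ {x} (p : Path G) → Adj G x (end p) → x ≢ next p → Path G
  extend {x} (mkPath u v ws unique linked) x~u x≢v = mkPath x u (v ∷ ws)
    ((adj⇒≢ G x~u ∷ x≢v ∷ ¬Any⇒All¬ ws (forest-no-chord unique linked (adj-sym G x~u))) ∷ unique)
    (x~u ∷ linked)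

  beyond-fresh : ∀ {z} (p : Path G) → Adj G (next p) z → z ≢ afterNext p → All (z ≢_) (beyond p)
  beyond-fresh (mkPath u v [] _ _) _ _ = []
  beyond-fresh (mkPath u v (w ∷ ws) (_ ∷ unique) (_ ∷ linked)) v~z z≢w =
    z≢w ∷ ¬Any⇒All¬ ws (forest-no-chord unique linked v~z)

  reroute : ∀ {z} (p : Path G) → Adj G (next p) z → z ≢ afterNext p → Path G
  reroute {z} p v~z z≢w = mkPath z (next p) (beyond p)
    ((adj⇒≢ G (adj-sym G v~z) ∷ beyond-fresh p v~z z≢w) ∷ AllPairs.tail (unique p))
    (adj-sym G v~z ∷ Linked.tail (linked p))

  -- grow a path at its end until the end is a leaf and no neighbour of next other than
  -- afterNext starts a longer path; the fuel k is enough since paths have at most n vertices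
  findStar : ∀ k (p : Path G) → n < length (vertices p) + k → PendantStar G
  findStar zero p n<len =
    contradiction (path-length≤ p) (<⇒≱ (subst (n <_) (+-identityʳ _) n<len))
  findStar (suc k) p n<len with otherNeighbour? G (end p) (next p)
  ... | yes (x , end~x , x≢next) =
    findStar k (extend p (adj-sym G end~x) x≢next) n<len′
    where n<len′ = subst (n <_) (+-suc _ k) n<len
  ... | no end-pendant
    with any? (λ z → T? (adj G (next p) z) ×-dec ¬? (z ≟ᶠ afterNext p)
                     ×-dec otherNeighbour? G z (next p))
  ...   | yes (z , next~z , z≢w , z′ , z~z′ , z′≢next) =
    findStar k (extend (reroute p next~z z≢w) (adj-sym G z~z′) z′≢next) n<len′
    where n<len′ = subst (n <_) (+-suc _ k) n<len
  ...   | no no-branch = record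
    { centre = next p ; leaf = end p ; exit = afterNext p
    ; leaf-pendant = pendant-unless-other G (end~next p) end-pendant
    ; neighbour-pendant = neighbour-pendant }
    where
    neighbour-pendant : ∀ z → Adj G (next p) z → z ≡ afterNext p ⊎ Pendant G z (next p)
    neighbour-pendant z next~z with z ≟ᶠ afterNext p
    ... | yes z≡w = inj₁ z≡w
    ... | no z≢w = inj₂ (pendant-unless-other G (adj-sym G next~z)
                           λ other → no-branch (z , next~z , z≢w , other))

  pendantStar : ∀ {a b} → Adj G a b → PendantStar G
  pendantStar a~b = findStar n edge (m<n+m n (s≤s z≤n))
    where
    b~a = adj-sym G a~b
    edge = mkPath _ _ [] ((adj⇒≢ G b~a ∷ []) ∷ [] ∷ []) (b~a ∷ [-])

-- Deleting the edges at a vertex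

_⊆ᴱ_ : Graph n → Graph n → Set
H ⊆ᴱ G = ∀ {x y} → Adj H x y → Adj G x y

Isolated : Graph n → Fin n → Set
Isolated G x = ∀ y → ¬ Adj G x y

forest-⊆ᴱ : {H G : Graph n} → H ⊆ᴱ G → IsForest G → IsForest H
forest-⊆ᴱ H⊆G forest cycle = forest record
  { v₀ = v₀ ; v₁ = v₁ ; v₂ = v₂ ; rest = rest ; distinct = distinct
  ; path = Linked.map H⊆G path ; closing = H⊆G closing }
  where open Cycle cycle

hasNeighbour : Graph n → Fin n → Bool
hasNeighbour G x = any (adj G x) (allFin _)

nonIsolatedCount : Graph n → ℕ
nonIsolatedCount G = countB (hasNeighbour G)

module _ (G : Graph n) where

  hasNeighbour⁺ : ∀ {x y} → Adj G x y → T (hasNeighbour G x)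
  hasNeighbour⁺ {y = y} x~y = any⁺ _ (lose (∈-allFin y) x~y)

  hasNeighbour⁻ : ∀ {x} → T (hasNeighbour G x) → ∃ (Adj G x)
  hasNeighbour⁻ = satisfied ∘ any⁻ _ (allFin n)

nonIsolatedCount-< : {H G : Graph n} {c d : Fin n} → H ⊆ᴱ G → Adj G c d → Isolated H c →
                     nonIsolatedCount H < nonIsolatedCount G
nonIsolatedCount-< {H = H} {G} H⊆G c~d c-isolated = countB-< {p = hasNeighbour H} {q = hasNeighbour G}
  (λ hx → hasNeighbour⁺ G (H⊆G (proj₂ (hasNeighbour⁻ H hx))))
  (hasNeighbour⁺ G c~d)
  (λ hc → let y , c~y = hasNeighbour⁻ H hc in c-isolated y c~y)

endpoint-has-neighbour : {H : Graph n} {M : List (Fin n × Fin n)} → All (λ { (u , v) → Adj H u v }) M →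
                         ∀ {t} → t ∈ endpoints M → ∃ (Adj H t)
endpoint-has-neighbour (u~v ∷ _) (here refl) = _ , u~v
endpoint-has-neighbour {H = H} (u~v ∷ _) (there (here refl)) = _ , adj-sym H u~v
endpoint-has-neighbour {H = H} (_ ∷ edges) (there (there t∈)) = endpoint-has-neighbour {H = H} edges t∈

matching-∷ : {H G : Graph n} {M : List (Fin n × Fin n)} {x y : Fin n} → H ⊆ᴱ G → IsMatching H M →
             Adj G x y → Isolated H x → Isolated H y → IsMatching G ((x , y) ∷ M)
matching-∷ {H = H} {G} {M} H⊆G (edges , unique) x~y x-isolated y-isolated =
  (x~y ∷ All.map H⊆G edges) , ((adj⇒≢ G x~y ∷ fresh x-isolated) ∷ fresh y-isolated ∷ unique)
  where
  fresh : ∀ {z} → Isolated H z → All (z ≢_) (endpoints M)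
  fresh z-isolated = All.tabulate λ { t∈ refl →
    let u , t~u = endpoint-has-neighbour {H = H} edges t∈ in z-isolated u t~u }

isolate : Graph n → Fin n → Graph n
isolate G c = record
  { adj = λ x y → adj G x y ∧ not (does (x ≟ᶠ c)) ∧ not (does (y ≟ᶠ c))
  ; sym = λ x y → cong₂ _∧_ (Graph.sym G x y) (∧-comm (not (does (x ≟ᶠ c))) _)
  ; irrefl = λ x → cong (_∧ _) (irrefl G x) }

module _ (G : Graph n) (c : Fin n) where

  isolate-⊆ᴱ : isolate G c ⊆ᴱ G
  isolate-⊆ᴱ = proj₁ ∘ Equivalence.to T-∧

  isolate-isolated : Isolated (isolate G c) c
  isolate-isolated y c~y = T-does⁻ (¬? (c ≟ᶠ c)) (proj₁ (Equivalence.to T-∧ c≠c∧y≠c)) refl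
    where c≠c∧y≠c = proj₂ (Equivalence.to (T-∧ {adj G c y}) c~y)

  adj-isolate⁺ : ∀ {x y} → Adj G x y → x ≢ c → y ≢ c → Adj (isolate G c) x y
  adj-isolate⁺ {x} {y} x~y x≢c y≢c = Equivalence.from T-∧
    (x~y , Equivalence.from T-∧ (T-does⁺ (¬? (x ≟ᶠ c)) x≢c , T-does⁺ (¬? (y ≟ᶠ c)) y≢c))

  degree-isolate : ∀ {x} → x ≢ c → ¬ Adj G x c → degree (isolate G c) x ≡ degree G x
  degree-isolate {x} x≢c x≁c = ≤-antisym
    (Unique-⊆⇒length≤ {ys = neighbours G x} (satisfying-unique (adj (isolate G c) x))
      (∈-satisfying⁺ ∘ isolate-⊆ᴱ ∘ ∈-satisfying⁻))
    (Unique-⊆⇒length≤ {ys = neighbours (isolate G c) x} (satisfying-unique (adj G x))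
      (∈-satisfying⁺ ∘ kept ∘ ∈-satisfying⁻))
    where
    kept : ∀ {y} → Adj G x y → Adj (isolate G c) x y
    kept x~y = adj-isolate⁺ x~y x≢c λ { refl → x≁c x~y }

-- The lower bound

LargeMatching : Graph n → Set
LargeMatching G = ∃ λ M → IsMatching G M × deg≥2Count G + suppCount G ≤ 3 * length M

module StarRemoval {G : Graph n} (star : PendantStar G) where
  open PendantStar star

  G′ : Graph n
  G′ = isolate G centre

  G′⊆ᴱG : G′ ⊆ᴱ G
  G′⊆ᴱG = isolate-⊆ᴱ G centre

  leaf-isolated : Isolated G′ leaf
  leaf-isolated y leaf~y = isolate-isolated G centre leaf
    (subst (λ t → Adj G′ t leaf) (proj₂ leaf-pendant y (G′⊆ᴱG leaf~y)) (adj-sym G′ leaf~y))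

  centre~leaf : Adj G centre leaf
  centre~leaf = adj-sym G (proj₁ leaf-pendant)

  nonIsolatedCount-shrinks : nonIsolatedCount G′ < nonIsolatedCount G
  nonIsolatedCount-shrinks =
    nonIsolatedCount-< {H = G′} {G} G′⊆ᴱG centre~leaf (isolate-isolated G centre)

  matching-extends : ∀ {M} → IsMatching G′ M → IsMatching G ((centre , leaf) ∷ M)
  matching-extends matching =
    matching-∷ {H = G′} {G} G′⊆ᴱG matching centre~leaf (isolate-isolated G centre) leaf-isolated

  deg≥2-lost : ∀ {x} → T (hasDeg≥2 G x) → T (hasDeg≥2 G′ x) ⊎ x ≡ exit ⊎ x ≡ centre
  deg≥2-lost {x} x∈D = by-cases (x ≟ᶠ centre) (x ≟ᶠ exit) (T? (adj G x centre))
    where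
    deg≥2 = T-does⁻ (2 ≤? degree G x) x∈D
    by-cases : Dec (x ≡ centre) → Dec (x ≡ exit) → Dec (Adj G x centre) →
               T (hasDeg≥2 G′ x) ⊎ x ≡ exit ⊎ x ≡ centre
    by-cases (yes x≡c) _         _         = inj₂ (inj₂ x≡c)
    by-cases (no _)    (yes x≡w) _         = inj₂ (inj₁ x≡w)
    by-cases (no _)    (no x≢w)  (yes x~c) with neighbour-pendant x (adj-sym G x~c)
    ... | inj₁ x≡w = contradiction x≡w x≢w
    ... | inj₂ x-pendant =
      contradiction (subst (2 ≤_) (pendant⇒degree≡1 G x-pendant) deg≥2) (<-irrefl refl)
    by-cases (no x≢c)  (no _)    (no x≁c)  =
      inj₁ (T-does⁺ (2 ≤? degree G′ x) (subst (2 ≤_) (sym (degree-isolate G centre x≢c x≁c)) deg≥2))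

  support-lost : ∀ {x} → T (isSupport G x) →
                 T (isSupport G′ x) ⊎ x ≡ centre ⊎ (x ≡ leaf × degree G centre ≡ 1)
  support-lost {x} x∈S with y , x~y , y-leaf ← support⁻ G x∈S =
    by-cases (x ≟ᶠ centre) (y ≟ᶠ centre)
    where
    by-cases : Dec (x ≡ centre) → Dec (y ≡ centre) →
               T (isSupport G′ x) ⊎ x ≡ centre ⊎ (x ≡ leaf × degree G centre ≡ 1)
    by-cases (yes x≡c) _ = inj₂ (inj₁ x≡c)
    by-cases (no _) (yes refl) =
      inj₂ (inj₂ (sym (proj₂ (degree≡1⇒pendant G y-leaf (adj-sym G x~y)) leaf centre~leaf) , y-leaf))
    by-cases (no x≢c) (no y≢c) =
      inj₁ (support⁺ G′ (adj-isolate⁺ G centre x~y x≢c y≢c)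
                        (trans (degree-isolate G centre y≢c y≁c) y-leaf))
      where
      y≁c : ¬ Adj G y centre
      y≁c y~c = x≢c (proj₂ (degree≡1⇒pendant G y-leaf y~c) x (adj-sym G x~y))

  -- Only centre and exit can leave Deg≥2 and only centre and leaf can leave Supp, but the leaf
  -- leaves Supp only when the centre is itself a leaf, and then the centre was not in Deg≥2.
  loss≤3-when-centre-leaf : degree G centre ≡ 1 →
                            deg≥2Count G + suppCount G ≤ deg≥2Count G′ + suppCount G′ + 3
  loss≤3-when-centre-leaf centre-leaf = ≤-trans
    (+-mono-≤ (countB-⊆-∪ (exit ∷ []) D-case) (countB-⊆-∪ (centre ∷ leaf ∷ []) S-case))
    (≤-reflexive (+-interchange (deg≥2Count G′) 1 (suppCount G′) 2))
    where
    D-case : ∀ {x} → T (hasDeg≥2 G x) → T (hasDeg≥2 G′ x) ⊎ x ∈ exit ∷ []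
    D-case x∈D with deg≥2-lost x∈D
    ... | inj₁ x∈D′ = inj₁ x∈D′
    ... | inj₂ (inj₁ x≡w) = inj₂ (here x≡w)
    ... | inj₂ (inj₂ refl) =
      contradiction (subst (2 ≤_) centre-leaf (T-does⁻ (2 ≤? degree G centre) x∈D)) (<-irrefl refl)
    S-case : ∀ {x} → T (isSupport G x) → T (isSupport G′ x) ⊎ x ∈ centre ∷ leaf ∷ []
    S-case x∈S with support-lost x∈S
    ... | inj₁ x∈S′ = inj₁ x∈S′
    ... | inj₂ (inj₁ x≡c) = inj₂ (here x≡c)
    ... | inj₂ (inj₂ (x≡ℓ , _)) = inj₂ (there (here x≡ℓ))

  loss≤3-when-centre-inner : degree G centre ≢ 1 →
                             deg≥2Count G + suppCount G ≤ deg≥2Count G′ + suppCount G′ + 3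
  loss≤3-when-centre-inner centre-inner = ≤-trans
    (+-mono-≤ (countB-⊆-∪ (exit ∷ centre ∷ []) D-case) (countB-⊆-∪ (centre ∷ []) S-case))
    (≤-reflexive (+-interchange (deg≥2Count G′) 2 (suppCount G′) 1))
    where
    D-case : ∀ {x} → T (hasDeg≥2 G x) → T (hasDeg≥2 G′ x) ⊎ x ∈ exit ∷ centre ∷ []
    D-case x∈D with deg≥2-lost x∈D
    ... | inj₁ x∈D′ = inj₁ x∈D′
    ... | inj₂ (inj₁ x≡w) = inj₂ (here x≡w)
    ... | inj₂ (inj₂ x≡c) = inj₂ (there (here x≡c))
    S-case : ∀ {x} → T (isSupport G x) → T (isSupport G′ x) ⊎ x ∈ centre ∷ []
    S-case x∈S with support-lost x∈S
    ... | inj₁ x∈S′ = inj₁ x∈S′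
    ... | inj₂ (inj₁ x≡c) = inj₂ (here x≡c)
    ... | inj₂ (inj₂ (_ , centre-leaf)) = contradiction centre-leaf centre-inner

  loss≤3 : deg≥2Count G + suppCount G ≤ deg≥2Count G′ + suppCount G′ + 3
  loss≤3 with degree G centre ≟ 1
  ... | yes centre-leaf  = loss≤3-when-centre-leaf centre-leaf
  ... | no centre-inner = loss≤3-when-centre-inner centre-inner

  largeMatching-lift : LargeMatching G′ → LargeMatching G
  largeMatching-lift (M′ , matching′ , bound′) =
    (centre , leaf) ∷ M′ , matching-extends matching′ , (begin
    deg≥2Count G + suppCount G       ≤⟨ loss≤3 ⟩
    deg≥2Count G′ + suppCount G′ + 3 ≤⟨ +-monoˡ-≤ 3 bound′ ⟩
    3 * length M′ + 3                ≡⟨ +-comm (3 * length M′) 3 ⟩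
    3 + 3 * length M′                ≡⟨ *-suc 3 (length M′) ⟨
    3 * suc (length M′)              ∎)
    where open ≤-Reasoning

edgeless-counts : (G : Graph n) → ¬ (∃ λ x → ∃ (Adj G x)) → deg≥2Count G + suppCount G ≤ 0
edgeless-counts G edgeless = +-mono-≤
  (countB-none λ x deg≥2 → contradiction
    (≤-trans (T-does⁻ (2 ≤? degree G x) deg≥2) (countB-none λ y x~y → edgeless (x , y , x~y))) λ ())
  (countB-none λ x supp → let y , x~y , _ = support⁻ G supp in edgeless (x , y , x~y))

matching-lower : ∀ k (G : Graph n) → nonIsolatedCount G < k → IsForest G → LargeMatching G
matching-lower (suc k) G bound forest with any? (λ x → any? (λ y → T? (adj G x y)))
... | no edgeless = [] , ([] , []) , edgeless-counts G edgeless
... | yes (_ , _ , a~b) = largeMatching-lift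
  (matching-lower k G′ (≤-trans nonIsolatedCount-shrinks (≤-pred bound))
                       (forest-⊆ᴱ {H = G′} {G} G′⊆ᴱG forest))
  where open StarRemoval (pendantStar forest a~b)

-- Isolated vertices lie in neither Deg≥2 nor Supp.
theorem15 : ∀ (n : ℕ) (F : Graph n) → IsForest F → NoIsolatedVertices F →
            (M : List (Fin n × Fin n)) → IsMaximumMatching F M →
            (deg≥2Count F + suppCount F ≤ 3 * length M)
            × (2 * length M ≤ deg≥2Count F + suppCount F)
theorem15 n F forest _ M (matching , maximum)
  with M′ , matching′ , bound ← matching-lower (suc (nonIsolatedCount F)) F ≤-refl forest =
  ≤-trans bound (*-monoʳ-≤ 3 (maximum M′ matching′)) , matching-upper F matching
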